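{- Let $P_1,P_2$ be processes each satisfying \texttt{price-time priority}, \texttt{positive bid-ask spread} and \texttt{conservation}. Let $(B,A)$ be an order-domain and $(\Delta,\omega)$ an instruction such that $((B,A),(\Delta,\omega))$ is a legal-input, and let $P_i(B,A,(\Delta,\omega))=(\hat B_i,\hat A_i,M_i)$ for $i=1,2$. Then $(\hat B_1,\hat A_1,\mathcal C(M_1))=(\hat B_2,\hat A_2,\mathcal C(M_2))$. Moreover, for each $i\in\{1,2\}$: (1) $(\hat B_i,\hat A_i)$ is not matchable; (2) the timestamps of the orders in $\hat B_i\cup\hat A_i$ are pairwise distinct and form a subset of the set of timestamps of orders in $B\cup A\cup\{\omega\}$; (3) the ids of the orders in $\hat B_i\cup\hat A_i$ are pairwise distinct and form a subset of $\mathsf{ids}(B\cup A)\cup\{\mathsf{id}(\omega)\}$; (4) if $\Delta=\mathsf{Del}$ then $\mathsf{id}(\omega)\notin\mathsf{ids}(\hat B_i\cup\hat A_i)$.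
   Context: An order is a 4-tuple $\omega=(\mathsf{id}(\omega),\mathsf{timestamp}(\omega),\mathsf{qty}(\omega),\mathsf{price}(\omega))$ of natural numbers with $\mathsf{qty}(\omega)>0$; $\mathsf{ids}(S)$ is the set of ids of orders in $S$. An order-domain is a pair $(B,A)$ of finite sets of orders ($B$ = bids, $A$ = asks); it is admissible if all orders in $B\cup A$ have pairwise distinct ids and pairwise distinct timestamps. A bid $b$ and ask $a$ are tradable if $\mathsf{price}(b)\ge\mathsf{price}(a)$; $(B,A)$ is matchable if some $b\in B$, $a\in A$ are tradable. Competitiveness: bid $b_1\succ b_2$ iff $\mathsf{price}(b_1)>\mathsf{price}(b_2)$, or prices equal and $\mathsf{timestamp}(b_1)<\mathsf{timestamp}(b_2)$; ask $a_1\succ a_2$ iff $\mathsf{price}(a_1)<\mathsf{price}(a_2)$, or prices equal and $\mathsf{timestamp}(a_1)<\mathsf{timestamp}(a_2)$. A transaction is a triple $t=(\mathsf{id_{bid}}(t),\mathsf{id_{ask}}(t),\mathsf{qty}(t))$ of natural numbers with $\mathsf{qty}(t)>0$. It is valid w.r.t. $(B,A)$ if there are $b\in B$, $a\in A$ with $\mathsf{id_{bid}}(t)=\mathsf{id}(b)$, $\mathsf{id_{ask}}(t)=\mathsf{id}(a)$, $b,a$ tradable, and $\mathsf{qty}(t)\le\min(\mathsf{qty}(b),\mathsf{qty}(a))$. For a finite set of transactions $T$, $\mathsf{Qty}(T,id)$ is the sum of quantities of transactions in $T$ whose bid id (for a bid) resp. ask id (for an ask) equals $id$; $\mathsf{ids_{bid}}(T),\mathsf{ids_{ask}}(T)$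 are the sets of bid/ask ids occurring in $T$. A matching over an admissible $(B,A)$ is a set $M$ of transactions valid w.r.t. $(B,A)$ with $\mathsf{Qty}(M,\mathsf{id}(\omega))\le\mathsf{qty}(\omega)$ for all $\omega\in B\cup A$. The canonical form $\mathcal C(M)$ is the set of transactions containing, for each bid id/ask id pair with positive total quantity in $M$, exactly one transaction between them whose quantity equals that total (and no other transactions). $\mathsf{Bids}(M,B)$ is the set of bids of $B$ occurring in $M$ with quantity replaced by $\mathsf{Qty}(M,\mathsf{id}(b))$; $\mathsf{Asks}(M,A)$ likewise. Sets of orders are viewed as multisets where each order (quantity field suppressed) has multiplicity equal to its quantity; $S_1-S_2$ is multiset difference. An instruction is a pair $(\Delta,\omega)$ with command $\Delta\in\{\mathsf{Buy},\mathsf{Sell},\mathsf{Del}\}$ and an order $\omega$. $\mathsf{Absorb}(B,A,(\mathsf{Del},\omega))=(\{b\in B:\mathsf{id}(b)\ne\mathsf{id}(\omega)\},\{a\in A:\mathsf{id}(a)\ne\mathsf{id}(\omega)\})$, $\mathsf{Absorb}(B,A,(\mathsf{Buy},\beta))=(B\cup\{\beta\},A)$, $\mathsf{Absorb}(B,A,(\mathsf{Sell},\alpha))=(B,A\cup\{\alpha\})$. $((B,A),\tau)$ is a legal-input if $(B,A)$ is not matchable and $\mathsf{Absorb}(B,A,\tau)$ is admissible. A process is a function $P:(B,A,\tau)\mapsto(\hat B,\hat A,M)$ (two sets of orders and an instruction to two sets of orders and a set of transactions). For every legal-input $((B,A),\tau)$ with $P(B,A,\tau)=(\hat B,\hat A,M)$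 and $(B',A')=\mathsf{Absorb}(B,A,\tau)$, $P$ satisfies: \texttt{positive bid-ask spread} if $(\hat B,\hat A)$ is not matchable; \texttt{price-time priority} if for all $a,a'\in A'$ with $a\succ a'$ and $\mathsf{id}(a')\in\mathsf{ids_{ask}}(M)$ we have $\mathsf{Qty}(M,\mathsf{id}(a))=\mathsf{qty}(a)$, and for all $b,b'\in B'$ with $b\succ b'$ and $\mathsf{id}(b')\in\mathsf{ids_{bid}}(M)$ we have $\mathsf{Qty}(M,\mathsf{id}(b))=\mathsf{qty}(b)$; \texttt{conservation} if $M$ is a matching over $(B',A')$, $\hat B=B'-\mathsf{Bids}(M,B')$ and $\hat A=A'-\mathsf{Asks}(M,A')$. A process satisfies a property if it does so for all legal-inputs. -}

module Defs where

open import Data.Nat using (ℕ; zero; suc; _≤_; _<_; _>_; _∸_; _+_; _⊓_; _≟_)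
open import Data.Nat.Properties using (<-≤-trans; m≤m+n; m≤n+m)
open import Data.Bool using (Bool; true; false; if_then_else_; _∧_)
open import Data.List using (List; []; _∷_; _++_; map; filter; [_])
open import Data.List.Relation.Unary.Any using (Any; here; there; any?)
open import Data.List.Membership.Propositional using (_∈_; _∉_)
open import Data.List.Membership.Propositional.Properties using (∈-map⁻)
open import Data.Product using (Σ; ∃; _×_; _,_)
open import Relation.Nullary using (¬_; Dec; yes; no; does; ¬?)
open import Relation.Nullary.Negation using (contradiction)
open import Relation.Nullary.Decidable using (dec-true)
open import Relation.Binary.Definitions using (DecidableEquality)
open import Relation.Binary.PropositionalEquality using (_≡_; refl; sym)
open import Function.Bundles using (_⇔_)

record Order : Set where
  constructor order
  field
    id        : ℕ
    timestamp : ℕ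
    qty       : ℕ
    price     : ℕ
    .qty>0    : qty > 0
open Order public

record Transaction : Set where
  constructor transaction
  field
    idBid : ℕ
    idAsk : ℕ
    tqty  : ℕ
    .tqty>0 : tqty > 0
open Transaction public

_≟ₒ_ : DecidableEquality Order
order i t q p _ ≟ₒ order i' t' q' p' _ with i ≟ i' | t ≟ t' | q ≟ q' | p ≟ p'
... | yes refl | yes refl | yes refl | yes refl = yes refl
... | no ne | _ | _ | _ = no λ { refl → ne refl }
... | yes _ | no ne | _ | _ = no λ { refl → ne refl }
... | yes _ | yes _ | no ne | _ = no λ { refl → ne refl }
... | yes _ | yes _ | yes _ | no ne = no λ { refl → ne refl }

_≟ₜ_ : DecidableEquality Transaction
transaction i j q _ ≟ₜ transaction i' j' q' _ with i ≟ i' | j ≟ j' | q ≟ q'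
... | yes refl | yes refl | yes refl = yes refl
... | no ne | _ | _ = no λ { refl → ne refl }
... | yes _ | no ne | _ = no λ { refl → ne refl }
... | yes _ | yes _ | no ne = no λ { refl → ne refl }

-- Finite sets are represented by lists, read up to membership
-- (duplicates and order are irrelevant).

_≐_ : {X : Set} → List X → List X → Set
S ≐ S' = ∀ x → (x ∈ S) ⇔ (x ∈ S')

_≐ₚ_ : {X : Set} → (X → Set) → (X → Set) → Set
P ≐ₚ Q = ∀ x → P x ⇔ Q x

sumSet : {X : Set} → DecidableEquality X → (X → ℕ) → List X → ℕ
sumSet eq f [] = 0
sumSet eq f (x ∷ xs) = if does (any? (eq x) xs) then sumSet eq f xs else f x + sumSet eq f xs

sumSet-pos : {X : Set} (eq : DecidableEquality X) (f : X → ℕ) {x : X} (xs : List X) →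
             x ∈ xs → 0 < f x → 0 < sumSet eq f xs
sumSet-pos eq f (y ∷ ys) (here refl) p with any? (eq y) ys
... | yes y∈ = sumSet-pos eq f ys y∈ p
... | no _ = <-≤-trans p (m≤m+n _ _)
sumSet-pos eq f (y ∷ ys) (there x∈) p with any? (eq y) ys
... | yes _ = sumSet-pos eq f ys x∈ p
... | no _ = <-≤-trans (sumSet-pos eq f ys x∈ p) (m≤n+m _ _)

ids : List Order → List ℕ
ids S = map id S

timestamps : List Order → List ℕ
timestamps S = map timestamp S

Admissible : List Order → List Order → Set
Admissible B A =
  (∀ {o₁ o₂} → o₁ ∈ B ++ A → o₂ ∈ B ++ A → id o₁ ≡ id o₂ → o₁ ≡ o₂) ×
  (∀ {o₁ o₂} → o₁ ∈ B ++ A → o₂ ∈ B ++ A → timestamp o₁ ≡ timestamp o₂ → o₁ ≡ o₂)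

Tradable : Order → Order → Set
Tradable b a = price a ≤ price b

Matchable : List Order → List Order → Set
Matchable B A = Σ Order λ b → Σ Order λ a → b ∈ B × a ∈ A × Tradable b a

_≻bid_ : Order → Order → Set
b₁ ≻bid b₂ = (price b₁ > price b₂) ⊎' (price b₁ ≡ price b₂ × timestamp b₁ < timestamp b₂)
  where
  open import Data.Sum using () renaming (_⊎_ to _⊎'_)

_≻ask_ : Order → Order → Set
a₁ ≻ask a₂ = (price a₁ < price a₂) ⊎' (price a₁ ≡ price a₂ × timestamp a₁ < timestamp a₂)
  where
  open import Data.Sum using () renaming (_⊎_ to _⊎'_)

ValidTx : List Order → List Order → Transaction → Set
ValidTx B A t = Σ Order λ b → Σ Order λ a →
  b ∈ B × a ∈ A × idBid t ≡ id b × idAsk t ≡ id a × Tradable b a ×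
  tqty t ≤ qty b ⊓ qty a

QtyBid : List Transaction → ℕ → ℕ
QtyBid T i = sumSet _≟ₜ_ (λ t → if does (idBid t ≟ i) then tqty t else 0) T

QtyAsk : List Transaction → ℕ → ℕ
QtyAsk T i = sumSet _≟ₜ_ (λ t → if does (idAsk t ≟ i) then tqty t else 0) T

idsBid : List Transaction → List ℕ
idsBid T = map idBid T

idsAsk : List Transaction → List ℕ
idsAsk T = map idAsk T

Matching : List Order → List Order → List Transaction → Set
Matching B A M =
  (∀ {t} → t ∈ M → ValidTx B A t) ×
  (∀ {b} → b ∈ B → QtyBid M (id b) ≤ qty b) ×
  (∀ {a} → a ∈ A → QtyAsk M (id a) ≤ qty a)

PairQty : List Transaction → ℕ → ℕ → ℕ
PairQty M i j = sumSet _≟ₜ_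
  (λ t → if does (idBid t ≟ i) ∧ does (idAsk t ≟ j) then tqty t else 0) M

-- The canonical form C(M), given by its membership predicate:
-- t ∈ C(M) iff qty(t) equals the total quantity in M between idBid t and idAsk t
-- (since qty(t) > 0 this only happens for pairs of positive total).
_∈C_ : Transaction → List Transaction → Set
t ∈C M = tqty t ≡ PairQty M (idBid t) (idAsk t)

C : List Transaction → Transaction → Set
C M t = t ∈C M

private
  qtyPos : (g : Transaction → ℕ) (M : List Transaction) (i : ℕ) →
           i ∈ map g M →
           0 < sumSet _≟ₜ_ (λ t → if does (g t ≟ i) then tqty t else 0) M
  qtyPos g M i i∈ with ∈-map⁻ g i∈
  ... | t , t∈ , eq = sumSet-pos _≟ₜ_ _ M t∈ (lem t (sym eq))
    where
    lem : ∀ t → g t ≡ i → 0 < (if does (g t ≟ i) then tqty t else 0)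
    lem t e rewrite dec-true (g t ≟ i) e = tpos t
      where
      tpos : ∀ t → 0 < tqty t
      tpos (transaction _ _ (suc q) _) = Data.Nat.s≤s Data.Nat.z≤n
        where import Data.Nat

bidOf : (M : List Transaction) (b : Order) → id b ∈ idsBid M → Order
bidOf M b p = order (id b) (timestamp b) (QtyBid M (id b)) (price b) (qtyPos idBid M (id b) p)

askOf : (M : List Transaction) (a : Order) → id a ∈ idsAsk M → Order
askOf M a p = order (id a) (timestamp a) (QtyAsk M (id a)) (price a) (qtyPos idAsk M (id a) p)

Bids : List Transaction → List Order → List Order
Bids M [] = []
Bids M (b ∷ B) with any? (id b ≟_) (idsBid M)
... | yes p = bidOf M b p ∷ Bids M B
... | no _ = Bids M B

Asks : List Transaction → List Order → List Order
Asks M [] = []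
Asks M (a ∷ A) with any? (id a ≟_) (idsAsk M)
... | yes p = askOf M a p ∷ Asks M A
... | no _ = Asks M A

-- multiplicity of the order (i, ts, _, p) (quantity suppressed) in the set S:
-- the sum of the quantities of the distinct orders of S with that id,
-- timestamp and price
mult : List Order → ℕ → ℕ → ℕ → ℕ
mult S i ts p = sumSet _≟ₒ_
  (λ o → if does (id o ≟ i) ∧ does (timestamp o ≟ ts) ∧ does (price o ≟ p)
         then qty o else 0) S

-- Ŝ = S₁ - S₂ (multiset difference, converted back to a set of orders:
-- each (id, ts, price) of positive multiplicity m becomes one order of qty m)
IsDiff : List Order → List Order → List Order → Set
IsDiff Ŝ S₁ S₂ = ∀ o → (o ∈ Ŝ) ⇔
  (qty o ≡ mult S₁ (id o) (timestamp o) (price o) ∸ mult S₂ (id o) (timestamp o) (price o))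

data Command : Set where
  Buy Sell Del : Command

Instruction : Set
Instruction = Command × Order

Absorb : List Order → List Order → Instruction → List Order × List Order
Absorb B A (Del , ω) = filter (λ b → ¬? (id b ≟ id ω)) B , filter (λ a → ¬? (id a ≟ id ω)) A
Absorb B A (Buy , β) = β ∷ B , A
Absorb B A (Sell , α) = B , α ∷ A

LegalInput : List Order → List Order → Instruction → Set
LegalInput B A τ = ¬ Matchable B A × (let (B' , A') = Absorb B A τ in Admissible B' A')

Process : Set
Process = List Order → List Order → Instruction → List Order × List Order × List Transaction

PositiveSpread : Process → Set
PositiveSpread P = ∀ B A τ → LegalInput B A τ →
  let (B̂ , Â , M) = P B A τ in ¬ Matchable B̂ Â

PriceTimePriority : Process → Set
PriceTimePriority P = ∀ B A τ → LegalInput B A τ →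
  let (B̂ , Â , M) = P B A τ
      (B' , A') = Absorb B A τ
  in (∀ {a a'} → a ∈ A' → a' ∈ A' → a ≻ask a' → id a' ∈ idsAsk M → QtyAsk M (id a) ≡ qty a) ×
     (∀ {b b'} → b ∈ B' → b' ∈ B' → b ≻bid b' → id b' ∈ idsBid M → QtyBid M (id b) ≡ qty b)

Conservation : Process → Set
Conservation P = ∀ B A τ → LegalInput B A τ →
  let (B̂ , Â , M) = P B A τ
      (B' , A') = Absorb B A τ
  in Matching B' A' M × IsDiff B̂ B' (Bids M B') × IsDiff Â A' (Asks M A')

OutputProperties : List Order → List Order → Command → Order → List Order → List Order → Set
OutputProperties B A Δ ω B̂ Â =
  ¬ Matchable B̂ Â ×
  ((∀ {o₁ o₂} → o₁ ∈ B̂ ++ Â → o₂ ∈ B̂ ++ Â → timestamp o₁ ≡ timestamp o₂ → o₁ ≡ o₂) ×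
   (∀ {o} → o ∈ B̂ ++ Â → timestamp o ∈ timestamps (B ++ A ++ [ ω ]))) ×
  ((∀ {o₁ o₂} → o₁ ∈ B̂ ++ Â → o₂ ∈ B̂ ++ Â → id o₁ ≡ id o₂ → o₁ ≡ o₂) ×
   (∀ {o} → o ∈ B̂ ++ Â → id o ∈ ids (B ++ A) ++ [ id ω ])) ×
  (Δ ≡ Del → id ω ∉ ids (B̂ ++ Â))

{-# OPTIONS --safe #-}
module Submission where

-- Since the book (B , A) is not matchable, every trade after a buy (sell) instruction involves the
-- incoming order, and after a delete instruction nothing trades. So a matching amounts to a fill of
-- the incoming order by the resting orders of the opposite side, and conservation, price-time
-- priority and positive spread say that this fill respects priority, fits into the incoming order,
-- and completely fills every eligible resting order unless the incoming order is used up. Such a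
-- fill is unique. The remaining books are multiset differences of the absorbed book and the
-- executed orders, so they and the canonical form of the matching depend only on the traded
-- quantities; the output properties hold because every remaining order keeps the id, timestamp
-- and price of an order of the absorbed book.

open import Defs
open import Data.Nat using (ℕ; suc; _+_; _≤_; _<_; _∸_; z≤n; s≤s)
open import Data.Nat.Properties
open import Algebra.Properties.CommutativeSemigroup +-commutativeSemigroup using (interchange)
open import Data.Bool using (if_then_else_; _∧_)
open import Data.Bool.Properties using (∧-identityʳ; ∧-zeroʳ)
open import Data.List using (List; []; _∷_; _++_; map; filter; [_])
open import Data.List.Properties using (map-++; ++-assoc)
open import Data.List.Relation.Unary.Any using (here; there; any?)
open import Data.List.Membership.Propositional using (_∈_; _∉_; find; lose)
open import Data.List.Membership.Propositional.Properties using (∈-map⁺; ∈-map⁻; ∈-++⁺ˡ; ∈-++⁺ʳ; ∈-++⁻; ∈-filter⁻)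
open import Data.List.Relation.Binary.Subset.Propositional using (_⊆_)
open import Data.List.Relation.Binary.Subset.Propositional.Properties using (xs⊆xs++ys; filter-⊆; ++⁺)
open import Data.Product using (∃; _×_; _,_; proj₁; proj₂; map₂)
open import Data.Sum using (_⊎_; inj₁; inj₂)
open import Data.Empty using (⊥-elim)
open import Function using (_∘_)
open import Function.Bundles using (Equivalence; mk⇔)
open import Function.Properties.Equivalence using () renaming (trans to ⇔-trans; sym to ⇔-sym)
open import Relation.Nullary using (¬_; Dec; yes; no; does; ¬?)
open import Relation.Nullary.Negation using (contradiction)
open import Relation.Nullary.Decidable using (dec-true; dec-false; _×-dec_)
open import Relation.Binary.Definitions using (DecidableEquality; tri<; tri≈; tri>)
open import Relation.Binary.PropositionalEquality using (_≡_; _≢_; refl; sym; trans; cong; cong₂; subst; module ≡-Reasoning)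

open Equivalence using (to; from)

module _ {X : Set} (_≟ₓ_ : DecidableEquality X) where

  sumSet-cong : ∀ {f g : X → ℕ} xs → (∀ {x} → x ∈ xs → f x ≡ g x) →
                sumSet _≟ₓ_ f xs ≡ sumSet _≟ₓ_ g xs
  sumSet-cong [] f≡g = refl
  sumSet-cong (x ∷ xs) f≡g with any? (x ≟ₓ_) xs
  ... | yes _ = sumSet-cong xs (λ x∈ → f≡g (there x∈))
  ... | no  _ = cong₂ _+_ (f≡g (here refl)) (sumSet-cong xs (λ x∈ → f≡g (there x∈)))

  sumSet-zero : ∀ {f : X → ℕ} xs → (∀ {x} → x ∈ xs → f x ≡ 0) → sumSet _≟ₓ_ f xs ≡ 0
  sumSet-zero [] f≡0 = refl
  sumSet-zero (x ∷ xs) f≡0 with any? (x ≟ₓ_) xs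
  ... | yes _ = sumSet-zero xs (λ x∈ → f≡0 (there x∈))
  ... | no  _ = cong₂ _+_ (f≡0 (here refl)) (sumSet-zero xs (λ x∈ → f≡0 (there x∈)))

  sumSet-single : ∀ (f : X → ℕ) xs {k} → k ∈ xs → (∀ {x} → x ∈ xs → x ≢ k → f x ≡ 0) →
                  sumSet _≟ₓ_ f xs ≡ f k
  sumSet-single f (x ∷ xs) k∈ f≡0 with any? (x ≟ₓ_) xs
  sumSet-single f (x ∷ xs) (here refl) f≡0 | yes x∈ = sumSet-single f xs x∈ (λ y∈ → f≡0 (there y∈))
  sumSet-single f (x ∷ xs) (there k∈) f≡0 | yes _ = sumSet-single f xs k∈ (λ y∈ → f≡0 (there y∈))
  sumSet-single f (x ∷ xs) (here refl) f≡0 | no x∉ =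
    trans (cong (f x +_) (sumSet-zero xs (λ y∈ → f≡0 (there y∈) (λ { refl → x∉ y∈ })))) (+-identityʳ _)
  sumSet-single f (x ∷ xs) {k} (there k∈) f≡0 | no x∉ with x ≟ₓ k
  ... | yes refl = contradiction k∈ x∉
  ... | no x≢k = cong₂ _+_ (f≡0 (here refl) x≢k) (sumSet-single f xs k∈ (λ y∈ → f≡0 (there y∈)))

  sumSet-pos⁻ : ∀ (f : X → ℕ) xs → 0 < sumSet _≟ₓ_ f xs → ∃ λ x → x ∈ xs × 0 < f x
  sumSet-pos⁻ f xs pos with any? (λ x → 0 <? f x) xs
  ... | yes some = find some
  ... | no none = contradiction (sumSet-zero xs (λ x∈ → n≤0⇒n≡0 (≮⇒≥ (none ∘ lose x∈)))) (>⇒≢ pos)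

  sumSet-+ : ∀ (f g : X → ℕ) xs →
             sumSet _≟ₓ_ (λ x → f x + g x) xs ≡ sumSet _≟ₓ_ f xs + sumSet _≟ₓ_ g xs
  sumSet-+ f g [] = refl
  sumSet-+ f g (x ∷ xs) with any? (x ≟ₓ_) xs
  ... | yes _ = sumSet-+ f g xs
  ... | no  _ = trans (cong (f x + g x +_) (sumSet-+ f g xs)) (interchange (f x) (g x) _ _)

  sumSet-mono-≤ : ∀ {f g : X → ℕ} xs → (∀ {x} → x ∈ xs → f x ≤ g x) →
                  sumSet _≟ₓ_ f xs ≤ sumSet _≟ₓ_ g xs
  sumSet-mono-≤ [] f≤g = z≤n
  sumSet-mono-≤ (x ∷ xs) f≤g with any? (x ≟ₓ_) xs
  ... | yes _ = sumSet-mono-≤ xs (λ x∈ → f≤g (there x∈))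
  ... | no  _ = +-mono-≤ (f≤g (here refl)) (sumSet-mono-≤ xs (λ x∈ → f≤g (there x∈)))

  sumSet-mono-< : ∀ {f g : X → ℕ} xs {k} → k ∈ xs → f k < g k → (∀ {x} → x ∈ xs → f x ≤ g x) →
                  sumSet _≟ₓ_ f xs < sumSet _≟ₓ_ g xs
  sumSet-mono-< (x ∷ xs) k∈ fk<gk f≤g with any? (x ≟ₓ_) xs
  sumSet-mono-< (x ∷ xs) (here refl) fk<gk f≤g | yes x∈ = sumSet-mono-< xs x∈ fk<gk (λ y∈ → f≤g (there y∈))
  sumSet-mono-< (x ∷ xs) (there k∈) fk<gk f≤g | yes _ = sumSet-mono-< xs k∈ fk<gk (λ y∈ → f≤g (there y∈))
  sumSet-mono-< (x ∷ xs) (here refl) fk<gk f≤g | no _ =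
    +-mono-<-≤ fk<gk (sumSet-mono-≤ xs (λ y∈ → f≤g (there y∈)))
  sumSet-mono-< (x ∷ xs) (there k∈) fk<gk f≤g | no _ =
    +-mono-≤-< (f≤g (here refl)) (sumSet-mono-< xs k∈ fk<gk (λ y∈ → f≤g (there y∈)))

sumSet-comm : ∀ {X Y : Set} (_≟ₓ_ : DecidableEquality X) (_≟ᵧ_ : DecidableEquality Y)
              (f : X → Y → ℕ) xs ys →
              sumSet _≟ₓ_ (λ x → sumSet _≟ᵧ_ (f x) ys) xs ≡ sumSet _≟ᵧ_ (λ y → sumSet _≟ₓ_ (λ x → f x y) xs) ys
sumSet-comm _≟ₓ_ _≟ᵧ_ f [] ys = sym (sumSet-zero _≟ᵧ_ ys (λ _ → refl))
sumSet-comm _≟ₓ_ _≟ᵧ_ f (x ∷ xs) ys with any? (x ≟ₓ_) xs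
... | yes _ = sumSet-comm _≟ₓ_ _≟ᵧ_ f xs ys
... | no  _ = trans (cong (sumSet _≟ᵧ_ (f x) ys +_) (sumSet-comm _≟ₓ_ _≟ᵧ_ f xs ys))
                    (sym (sumSet-+ _≟ᵧ_ (f x) _ ys))

if-yes : ∀ {P : Set} (d : Dec P) {n : ℕ} → P → (if does d then n else 0) ≡ n
if-yes (yes _) p = refl
if-yes (no ¬p) p = contradiction p ¬p

if-no : ∀ {P : Set} (d : Dec P) {n : ℕ} → ¬ P → (if does d then n else 0) ≡ 0
if-no (yes p) ¬p = contradiction p ¬p
if-no (no _) ¬p = refl

if-pos : ∀ {P : Set} (d : Dec P) {n : ℕ} → 0 < (if does d then n else 0) → P
if-pos (yes p) _ = p

tqty-pos : ∀ t → 0 < tqty t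
tqty-pos (transaction _ _ (suc _) _) = s≤s z≤n

qty-pos : ∀ o → 0 < qty o
qty-pos (order _ _ (suc _) _ _) = s≤s z≤n

-- QtyBid M ≡ Qty idBid M and QtyAsk M ≡ Qty idAsk M definitionally.
Qty : (Transaction → ℕ) → List Transaction → ℕ → ℕ
Qty g M i = sumSet _≟ₜ_ (λ t → if does (g t ≟ i) then tqty t else 0) M

volume : List Transaction → ℕ
volume M = sumSet _≟ₜ_ tqty M

module _ (g : Transaction → ℕ) (M : List Transaction) where

  Qty-pos⇒∈ : ∀ {i} → 0 < Qty g M i → i ∈ map g M
  Qty-pos⇒∈ {i} pos with sumSet-pos⁻ _≟ₜ_ _ M pos
  ... | t , t∈ , pos-t = subst (_∈ map g M) (if-pos (g t ≟ i) pos-t) (∈-map⁺ g t∈)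

  ∈⇒Qty-pos : ∀ {i} → i ∈ map g M → 0 < Qty g M i
  ∈⇒Qty-pos {i} i∈ with ∈-map⁻ g i∈
  ... | t , t∈ , refl = sumSet-pos _≟ₜ_ _ M t∈ (subst (0 <_) (sym (if-yes (g t ≟ g t) refl)) (tqty-pos t))

  Qty-outside : ∀ {J} → (∀ {t} → t ∈ M → g t ∈ J) → ∀ {i} → i ∉ J → Qty g M i ≡ 0
  Qty-outside g∈J i∉J = sumSet-zero _≟ₜ_ M (λ t∈ → if-no (g _ ≟ _) (λ { refl → i∉J (g∈J t∈) }))

  Qty-constant : ∀ {k} → (∀ {t} → t ∈ M → g t ≡ k) → Qty g M k ≡ volume M
  Qty-constant g≡k = sumSet-cong _≟ₜ_ M (λ t∈ → if-yes (g _ ≟ _) (g≡k t∈))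

  Qty-constant-other : ∀ {k} → (∀ {t} → t ∈ M → g t ≡ k) → ∀ {i} → i ≢ k → Qty g M i ≡ 0
  Qty-constant-other g≡k i≢k = sumSet-zero _≟ₜ_ M (λ t∈ → if-no (g _ ≟ _) (λ e → i≢k (trans (sym e) (g≡k t∈))))

  volume-by-Qty : ∀ {J} → (∀ {t} → t ∈ M → g t ∈ J) → volume M ≡ sumSet _≟_ (Qty g M) J
  volume-by-Qty {J} g∈J = sym (trans
    (sumSet-comm _≟_ _≟ₜ_ (λ j t → if does (g t ≟ j) then tqty t else 0) J M)
    (sumSet-cong _≟ₜ_ M (λ {t} t∈ →
      trans (sumSet-single _≟_ _ J (g∈J t∈) (λ _ j≢gt → if-no (g t ≟ _) (j≢gt ∘ sym)))
            (if-yes (g t ≟ g t) refl))))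

module _ {M : List Transaction} {k : ℕ} where

  PairQty-bid : (∀ {t} → t ∈ M → idBid t ≡ k) → ∀ j → PairQty M k j ≡ QtyAsk M j
  PairQty-bid bid≡k j = sumSet-cong _≟ₜ_ M (λ {t} t∈ → lemma t (bid≡k t∈))
    where
    lemma : ∀ t → idBid t ≡ k → (if does (idBid t ≟ k) ∧ does (idAsk t ≟ j) then tqty t else 0)
                               ≡ (if does (idAsk t ≟ j) then tqty t else 0)
    lemma t e rewrite dec-true (idBid t ≟ k) e = refl

  PairQty-other-bid : (∀ {t} → t ∈ M → idBid t ≡ k) → ∀ {i} j → i ≢ k → PairQty M i j ≡ 0
  PairQty-other-bid bid≡k {i} j i≢k = sumSet-zero _≟ₜ_ M (λ {t} t∈ → lemma t (λ e → i≢k (trans (sym e) (bid≡k t∈))))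
    where
    lemma : ∀ t → idBid t ≢ i → (if does (idBid t ≟ i) ∧ does (idAsk t ≟ j) then tqty t else 0) ≡ 0
    lemma t ne rewrite dec-false (idBid t ≟ i) ne = refl

  PairQty-ask : (∀ {t} → t ∈ M → idAsk t ≡ k) → ∀ i → PairQty M i k ≡ QtyBid M i
  PairQty-ask ask≡k i = sumSet-cong _≟ₜ_ M (λ {t} t∈ → lemma t (ask≡k t∈))
    where
    lemma : ∀ t → idAsk t ≡ k → (if does (idBid t ≟ i) ∧ does (idAsk t ≟ k) then tqty t else 0)
                               ≡ (if does (idBid t ≟ i) then tqty t else 0)
    lemma t e rewrite dec-true (idAsk t ≟ k) e | ∧-identityʳ (does (idBid t ≟ i)) = refl

  PairQty-other-ask : (∀ {t} → t ∈ M → idAsk t ≡ k) → ∀ i {j} → j ≢ k → PairQty M i j ≡ 0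
  PairQty-other-ask ask≡k i {j} j≢k = sumSet-zero _≟ₜ_ M (λ {t} t∈ → lemma t (λ e → j≢k (trans (sym e) (ask≡k t∈))))
    where
    lemma : ∀ t → idAsk t ≢ j → (if does (idBid t ≟ i) ∧ does (idAsk t ≟ j) then tqty t else 0) ≡ 0
    lemma t ne rewrite dec-false (idAsk t ≟ j) ne | ∧-zeroʳ (does (idBid t ≟ i)) = refl

-- An order with its quantity suppressed: the elements of the multisets that sets of orders stand for.
key : Order → ℕ × ℕ × ℕ
key o = id o , timestamp o , price o

≡-from-key : ∀ {o o'} → key o ≡ key o' → qty o ≡ qty o' → o ≡ o'
≡-from-key {order _ _ _ _ _} {order _ _ _ _ _} refl refl = refl

UniqueIds : List Order → Set
UniqueIds S = ∀ {o o'} → o ∈ S → o' ∈ S → id o ≡ id o' → o ≡ o'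

indicator : ℕ × ℕ × ℕ → Order → ℕ
indicator (i , ts , p) o = if does (id o ≟ i) ∧ does (timestamp o ≟ ts) ∧ does (price o ≟ p) then qty o else 0

multOf : List Order → ℕ × ℕ × ℕ → ℕ
multOf S (i , ts , p) = mult S i ts p

indicator-pos : ∀ k o → 0 < indicator k o → key o ≡ k
indicator-pos (i , ts , p) o pos
  with refl , refl , refl ← if-pos (id o ≟ i ×-dec timestamp o ≟ ts ×-dec price o ≟ p) pos = refl

indicator-self : ∀ o → indicator (key o) o ≡ qty o
indicator-self o rewrite dec-true (id o ≟ id o) refl | dec-true (timestamp o ≟ timestamp o) refl
                       | dec-true (price o ≟ price o) refl = refl

indicator-other : ∀ k o → id o ≢ proj₁ k → indicator k o ≡ 0
indicator-other (i , _ , _) o id≢i rewrite dec-false (id o ≟ i) id≢i = refl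

mult-pos⁻ : ∀ S k → 0 < multOf S k → ∃ λ b → b ∈ S × key b ≡ k
mult-pos⁻ S k@(_ , _ , _) pos = map₂ (λ {b} → map₂ (indicator-pos k b)) (sumSet-pos⁻ _≟ₒ_ (indicator k) S pos)

mult-absent : ∀ S {i ts p} → (∀ {o} → o ∈ S → id o ≢ i) → mult S i ts p ≡ 0
mult-absent S {i} {ts} {p} absent = sumSet-zero _≟ₒ_ S (λ {o} o∈ → indicator-other (i , ts , p) o (absent o∈))

mult-at : ∀ S {o} → o ∈ S → (∀ {x} → x ∈ S → id x ≡ id o → x ≡ o) → multOf S (key o) ≡ qty o
mult-at S {o} o∈ only-o =
  trans (sumSet-single _≟ₒ_ (indicator (key o)) S o∈ (λ {x} x∈ x≢o → indicator-other (key o) x (x≢o ∘ only-o x∈)))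
        (indicator-self o)

∃∈-there : ∀ {x : Order} {L : List Order} {R : Order → Set} →
               (∃ λ b → b ∈ L × R b) → ∃ λ b → b ∈ x ∷ L × R b
∃∈-there (b , b∈ , r) = b , there b∈ , r

Bids-∈⁻ : ∀ M L {o} → o ∈ Bids M L →
          ∃ λ b → b ∈ L × 0 < QtyBid M (id b) × key o ≡ key b × qty o ≡ QtyBid M (id b)
Bids-∈⁻ M (b ∷ L) o∈ with any? (id b ≟_) (idsBid M)
Bids-∈⁻ M (b ∷ L) (here refl) | yes traded = b , here refl , ∈⇒Qty-pos idBid M traded , refl , refl
Bids-∈⁻ M (b ∷ L) (there o∈)  | yes _ = ∃∈-there (Bids-∈⁻ M L o∈)
Bids-∈⁻ M (b ∷ L) o∈          | no _  = ∃∈-there (Bids-∈⁻ M L o∈)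

Bids-∈⁺ : ∀ M {L b} → b ∈ L → 0 < QtyBid M (id b) →
          ∃ λ o → o ∈ Bids M L × key o ≡ key b × qty o ≡ QtyBid M (id b)
Bids-∈⁺ M {b ∷ L} (here refl) pos with any? (id b ≟_) (idsBid M)
... | yes traded = bidOf M b traded , here refl , refl , refl
... | no untraded = contradiction (Qty-pos⇒∈ idBid M pos) untraded
Bids-∈⁺ M {b' ∷ L} (there b∈) pos with any? (id b' ≟_) (idsBid M)
... | yes _ = ∃∈-there (Bids-∈⁺ M b∈ pos)
... | no _  = Bids-∈⁺ M b∈ pos

Asks-∈⁻ : ∀ M L {o} → o ∈ Asks M L →
          ∃ λ a → a ∈ L × 0 < QtyAsk M (id a) × key o ≡ key a × qty o ≡ QtyAsk M (id a)
Asks-∈⁻ M (a ∷ L) o∈ with any? (id a ≟_) (idsAsk M)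
Asks-∈⁻ M (a ∷ L) (here refl) | yes traded = a , here refl , ∈⇒Qty-pos idAsk M traded , refl , refl
Asks-∈⁻ M (a ∷ L) (there o∈)  | yes _ = ∃∈-there (Asks-∈⁻ M L o∈)
Asks-∈⁻ M (a ∷ L) o∈          | no _  = ∃∈-there (Asks-∈⁻ M L o∈)

Asks-∈⁺ : ∀ M {L a} → a ∈ L → 0 < QtyAsk M (id a) →
          ∃ λ o → o ∈ Asks M L × key o ≡ key a × qty o ≡ QtyAsk M (id a)
Asks-∈⁺ M {a ∷ L} (here refl) pos with any? (id a ≟_) (idsAsk M)
... | yes traded = askOf M a traded , here refl , refl , refl
... | no untraded = contradiction (Qty-pos⇒∈ idAsk M pos) untraded
Asks-∈⁺ M {a' ∷ L} (there a∈) pos with any? (id a' ≟_) (idsAsk M)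
... | yes _ = ∃∈-there (Asks-∈⁺ M a∈ pos)
... | no _  = Asks-∈⁺ M a∈ pos

record Execution : Set where
  field
    executed : List Order → List Order
    traded   : ℕ → ℕ
    executed-∈⁻ : ∀ {L o} → o ∈ executed L →
                  ∃ λ b → b ∈ L × 0 < traded (id b) × key o ≡ key b × qty o ≡ traded (id b)
    executed-∈⁺ : ∀ {L b} → b ∈ L → 0 < traded (id b) →
                  ∃ λ o → o ∈ executed L × key o ≡ key b × qty o ≡ traded (id b)

bidExecution : List Transaction → Execution
bidExecution M = record { executed = Bids M ; traded = QtyBid M
                        ; executed-∈⁻ = Bids-∈⁻ M _ ; executed-∈⁺ = Bids-∈⁺ M }

askExecution : List Transaction → Execution
askExecution M = record { executed = Asks M ; traded = QtyAsk M
                        ; executed-∈⁻ = Asks-∈⁻ M _ ; executed-∈⁺ = Asks-∈⁺ M }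

remainder : (o : Order) (q : ℕ) → q < qty o → Order
remainder o q q<qty = order (id o) (timestamp o) (qty o ∸ q) (price o) (m<n⇒0<n∸m q<qty)

module _ (E : Execution) where
  open Execution E

  mult-executed : ∀ {L} → UniqueIds L → ∀ {b} → b ∈ L → multOf (executed L) (key b) ≡ traded (id b)
  mult-executed {L} uniq {b} b∈ with 0 <? traded (id b)
  ... | no untraded = trans (mult-absent (executed L) absent) (sym (n≤0⇒n≡0 (≮⇒≥ untraded)))
    where
    absent : ∀ {x} → x ∈ executed L → id x ≢ id b
    absent x∈ id≡ with b' , b'∈ , pos , k , _ ← executed-∈⁻ x∈
                  with refl ← uniq b'∈ b∈ (trans (sym (cong proj₁ k)) id≡) = untraded pos
  ... | yes pos with o , o∈ , kₒ , qₒ ← executed-∈⁺ b∈ pos = begin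
      multOf (executed L) (key b)  ≡⟨ cong (multOf (executed L)) (sym kₒ) ⟩
      multOf (executed L) (key o)  ≡⟨ mult-at (executed L) o∈ only-o ⟩
      qty o                        ≡⟨ qₒ ⟩
      traded (id b)                ∎
    where
    open ≡-Reasoning
    only-o : ∀ {x} → x ∈ executed L → id x ≡ id o → x ≡ o
    only-o x∈ id≡ with b' , b'∈ , _ , k , q ← executed-∈⁻ x∈
                  with refl ← uniq b'∈ b∈ (trans (sym (cong proj₁ k)) (trans id≡ (cong proj₁ kₒ))) =
      ≡-from-key (trans k (sym kₒ)) (trans q (sym qₒ))

  remainder-∈ : ∀ {L Ŝ} → UniqueIds L → IsDiff Ŝ L (executed L) →
                ∀ {b} → b ∈ L → (partial : traded (id b) < qty b) → remainder b (traded (id b)) partial ∈ Ŝ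
  remainder-∈ {L} uniq diff {b} b∈ partial =
    from (diff _) (sym (cong₂ _∸_ (mult-at L b∈ (λ x∈ → uniq x∈ b∈)) (mult-executed uniq b∈)))

module _ {Ŝ : List Order} (S T : List Order) (diff : IsDiff Ŝ S T) where

  IsDiff-origin : ∀ {o} → o ∈ Ŝ → ∃ λ b → b ∈ S × key b ≡ key o
  IsDiff-origin {o} o∈ = mult-pos⁻ S (key o)
    (<-≤-trans (subst (0 <_) (to (diff o) o∈) (qty-pos o)) (m∸n≤m (multOf S (key o)) (multOf T (key o))))

  IsDiff-key-injective : ∀ {o₁ o₂} → o₁ ∈ Ŝ → o₂ ∈ Ŝ → key o₁ ≡ key o₂ → o₁ ≡ o₂
  IsDiff-key-injective {o₁} {o₂} o₁∈ o₂∈ k≡ = ≡-from-key k≡ (begin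
    qty o₁                                  ≡⟨ to (diff o₁) o₁∈ ⟩
    multOf S (key o₁) ∸ multOf T (key o₁)   ≡⟨ cong (λ k → multOf S k ∸ multOf T k) k≡ ⟩
    multOf S (key o₂) ∸ multOf T (key o₂)   ≡⟨ to (diff o₂) o₂∈ ⟨
    qty o₂                                  ∎)
    where open ≡-Reasoning

IsDiff-≐ : ∀ {Ŝ₁ Ŝ₂ S T} → IsDiff Ŝ₁ S T → IsDiff Ŝ₂ S T → Ŝ₁ ≐ Ŝ₂
IsDiff-≐ diff₁ diff₂ o = ⇔-trans (diff₁ o) (⇔-sym (diff₂ o))

record Outcome (B' A' B̂ Â : List Order) (M : List Transaction) : Set where
  field
    spread       : ¬ Matchable B̂ Â
    ask-priority : ∀ {a a'} → a ∈ A' → a' ∈ A' → a ≻ask a' → id a' ∈ idsAsk M → QtyAsk M (id a) ≡ qty a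
    bid-priority : ∀ {b b'} → b ∈ B' → b' ∈ B' → b ≻bid b' → id b' ∈ idsBid M → QtyBid M (id b) ≡ qty b
    matching     : Matching B' A' M
    bids-rest    : IsDiff B̂ B' (Bids M B')
    asks-rest    : IsDiff Â A' (Asks M A')

module _ {B' A' B̂ Â : List Order} {M : List Transaction} (out : Outcome B' A' B̂ Â M) where
  open Outcome out

  output-origin : ∀ {o} → o ∈ B̂ ++ Â → ∃ λ b → b ∈ B' ++ A' × key b ≡ key o
  output-origin o∈ with ∈-++⁻ B̂ o∈
  ... | inj₁ o∈B̂ with b , b∈ , k ← IsDiff-origin B' (Bids M B') bids-rest o∈B̂ = b , ∈-++⁺ˡ b∈ , k
  ... | inj₂ o∈Â with a , a∈ , k ← IsDiff-origin A' (Asks M A') asks-rest o∈Â = a , ∈-++⁺ʳ B' a∈ , k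

  -- A bid and an ask sharing a key would share a price, hence be tradable.
  output-key-injective : ∀ {o₁ o₂} → o₁ ∈ B̂ ++ Â → o₂ ∈ B̂ ++ Â → key o₁ ≡ key o₂ → o₁ ≡ o₂
  output-key-injective {o₁} {o₂} o₁∈ o₂∈ k≡ with ∈-++⁻ B̂ o₁∈ | ∈-++⁻ B̂ o₂∈
  ... | inj₁ b₁ | inj₁ b₂ = IsDiff-key-injective B' (Bids M B') bids-rest b₁ b₂ k≡
  ... | inj₂ a₁ | inj₂ a₂ = IsDiff-key-injective A' (Asks M A') asks-rest a₁ a₂ k≡
  ... | inj₁ b₁ | inj₂ a₂ = ⊥-elim (spread (o₁ , o₂ , b₁ , a₂ , ≤-reflexive (sym (cong (proj₂ ∘ proj₂) k≡))))
  ... | inj₂ a₁ | inj₁ b₂ = ⊥-elim (spread (o₂ , o₁ , b₂ , a₁ , ≤-reflexive (cong (proj₂ ∘ proj₂) k≡)))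

  output-injective : (K : ℕ × ℕ × ℕ → ℕ) →
    (∀ {o₁ o₂} → o₁ ∈ B' ++ A' → o₂ ∈ B' ++ A' → K (key o₁) ≡ K (key o₂) → o₁ ≡ o₂) →
    ∀ {o₁ o₂} → o₁ ∈ B̂ ++ Â → o₂ ∈ B̂ ++ Â → K (key o₁) ≡ K (key o₂) → o₁ ≡ o₂
  output-injective K injective o₁∈ o₂∈ K≡
    with b₁ , b₁∈ , k₁ ← output-origin o₁∈ | b₂ , b₂∈ , k₂ ← output-origin o₂∈
    with refl ← injective b₁∈ b₂∈ (trans (cong K k₁) (trans K≡ (sym (cong K k₂)))) =
    output-key-injective o₁∈ o₂∈ (trans (sym k₁) k₂)

  output-within : (K : ℕ × ℕ × ℕ → ℕ) {S : List Order} → B' ++ A' ⊆ S →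
                  ∀ {o} → o ∈ B̂ ++ Â → K (key o) ∈ map (K ∘ key) S
  output-within K {S} B'A'⊆S o∈ with b , b∈ , k ← output-origin o∈ =
    subst (_∈ map (K ∘ key) S) (cong K k) (∈-map⁺ (K ∘ key) (B'A'⊆S b∈))

-- q (id a) is how much of the incoming order, of quantity `size`, is filled by the resting order a
-- of L, and `Eligible a` says that a is tradable with the incoming order.
module PriorityFill (L : List Order) (_≻_ : Order → Order → Set) (Eligible : Order → Set) (size : ℕ)
  (≻-connex : ∀ {a a'} → a ∈ L → a' ∈ L → id a ≢ id a' → a ≻ a' ⊎ a' ≻ a) where

  filled : (ℕ → ℕ) → ℕ
  filled q = sumSet _≟_ q (ids L)

  record IsPriorityFill (q : ℕ → ℕ) : Set where
    field
      bounded   : ∀ {a} → a ∈ L → q (id a) ≤ qty a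
      within    : filled q ≤ size
      priority  : ∀ {a a'} → a ∈ L → a' ∈ L → a ≻ a' → 0 < q (id a') → q (id a) ≡ qty a
      exhausted : filled q < size → ∀ {a} → a ∈ L → Eligible a → q (id a) ≡ qty a
      eligible  : ∀ {a} → a ∈ L → 0 < q (id a) → Eligible a
  open IsPriorityFill

  module _ {q₁ q₂ : ℕ → ℕ} (fill₁ : IsPriorityFill q₁) (fill₂ : IsPriorityFill q₂) where

    fill-dominated : ∀ {a} → a ∈ L → q₂ (id a) < q₁ (id a) → ∀ {a'} → a' ∈ L → q₂ (id a') ≤ q₁ (id a')
    fill-dominated {a} a∈ behind {a'} a'∈ with id a' ≟ id a
    ... | yes refl = <⇒≤ behind
    ... | no a'≢a with ≻-connex a∈ a'∈ (a'≢a ∘ sym)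
    ...   | inj₂ a'≻a = subst (q₂ (id a') ≤_) (sym (priority fill₁ a'∈ a∈ a'≻a (≤-<-trans z≤n behind))) (bounded fill₂ a'∈)
    ...   | inj₁ a≻a' with 0 <? q₂ (id a')
    ...     | yes pos = contradiction (priority fill₂ a∈ a'∈ a≻a' pos) (<⇒≢ (<-≤-trans behind (bounded fill₁ a∈)))
    ...     | no ¬pos = subst (_≤ q₁ (id a')) (sym (n≤0⇒n≡0 (≮⇒≥ ¬pos))) z≤n

    -- Falling behind at a (which is then eligible) is only possible when q₂ has used up the
    -- incoming order, but then domination makes q₂ fill strictly more than q₁, which fits into it.
    not-behind : ∀ {a} → a ∈ L → ¬ (q₂ (id a) < q₁ (id a))
    not-behind {a} a∈ behind with filled q₂ <? size
    ... | yes short = <⇒≱ behind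
          (subst (q₁ (id a) ≤_) (sym (exhausted fill₂ short a∈ (eligible fill₁ a∈ (≤-<-trans z≤n behind))))
                 (bounded fill₁ a∈))
    ... | no ¬short = ¬short (<-≤-trans (sumSet-mono-< _≟_ (ids L) (∈-map⁺ id a∈) behind dominated) (within fill₁))
      where
      dominated : ∀ {j} → j ∈ ids L → q₂ j ≤ q₁ j
      dominated j∈ with a' , a'∈ , refl ← ∈-map⁻ id j∈ = fill-dominated a∈ behind a'∈

  fill-unique : ∀ {q₁ q₂} → IsPriorityFill q₁ → IsPriorityFill q₂ → ∀ {a} → a ∈ L → q₁ (id a) ≡ q₂ (id a)
  fill-unique fill₁ fill₂ a∈ = ≤-antisym (≮⇒≥ (not-behind fill₁ fill₂ a∈)) (≮⇒≥ (not-behind fill₂ fill₁ a∈))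

record SameTrades (M₁ M₂ : List Transaction) : Set where
  field
    bid-qty  : ∀ i → QtyBid M₁ i ≡ QtyBid M₂ i
    ask-qty  : ∀ j → QtyAsk M₁ j ≡ QtyAsk M₂ j
    pair-qty : ∀ i j → PairQty M₁ i j ≡ PairQty M₂ i j

Qty-support : ∀ g {M₁ M₂} → (∀ i → Qty g M₁ i ≡ Qty g M₂ i) → ∀ {i} → i ∈ map g M₁ → i ∈ map g M₂
Qty-support g {M₁} {M₂} same i∈ = Qty-pos⇒∈ g M₂ (subst (0 <_) (same _) (∈⇒Qty-pos g M₁ i∈))

Bids-cong : ∀ {M₁ M₂} → (∀ i → QtyBid M₁ i ≡ QtyBid M₂ i) → ∀ L → Bids M₁ L ≡ Bids M₂ L
Bids-cong same [] = refl
Bids-cong {M₁} {M₂} same (b ∷ L) with any? (id b ≟_) (idsBid M₁) | any? (id b ≟_) (idsBid M₂)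
... | yes _ | yes _ = cong₂ _∷_ (≡-from-key refl (same (id b))) (Bids-cong same L)
... | no  _ | no  _ = Bids-cong same L
... | yes traded₁ | no untraded₂ = contradiction (Qty-support idBid same traded₁) untraded₂
... | no untraded₁ | yes traded₂ = contradiction (Qty-support idBid (sym ∘ same) traded₂) untraded₁

Asks-cong : ∀ {M₁ M₂} → (∀ j → QtyAsk M₁ j ≡ QtyAsk M₂ j) → ∀ L → Asks M₁ L ≡ Asks M₂ L
Asks-cong same [] = refl
Asks-cong {M₁} {M₂} same (a ∷ L) with any? (id a ≟_) (idsAsk M₁) | any? (id a ≟_) (idsAsk M₂)
... | yes _ | yes _ = cong₂ _∷_ (≡-from-key refl (same (id a))) (Asks-cong same L)
... | no  _ | no  _ = Asks-cong same L
... | yes traded₁ | no untraded₂ = contradiction (Qty-support idAsk same traded₁) untraded₂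
... | no untraded₁ | yes traded₂ = contradiction (Qty-support idAsk (sym ∘ same) traded₂) untraded₁

outcome-determined : ∀ {B' A' B̂₁ Â₁ B̂₂ Â₂ M₁ M₂} → SameTrades M₁ M₂ →
  Outcome B' A' B̂₁ Â₁ M₁ → Outcome B' A' B̂₂ Â₂ M₂ → (B̂₁ ≐ B̂₂) × (Â₁ ≐ Â₂) × (C M₁ ≐ₚ C M₂)
outcome-determined {B'} {A'} {B̂₁} {Â₁} {M₁ = M₁} {M₂} same out₁ out₂ =
  IsDiff-≐ {S = B'} {T = Bids M₂ B'} (subst (IsDiff B̂₁ B') (Bids-cong {M₁} {M₂} bid-qty B') (bids-rest out₁)) (bids-rest out₂) ,
  IsDiff-≐ {S = A'} {T = Asks M₂ A'} (subst (IsDiff Â₁ A') (Asks-cong {M₁} {M₂} ask-qty A') (asks-rest out₁)) (asks-rest out₂) ,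
  λ t → mk⇔ (λ e → trans e (pair-qty _ _)) (λ e → trans e (sym (pair-qty _ _)))
  where
  open SameTrades same
  open Outcome

module _ {M₁ M₂ : List Transaction} {k : ℕ} where

  sameTrades-single-bid : (∀ {t} → t ∈ M₁ → idBid t ≡ k) → (∀ {t} → t ∈ M₂ → idBid t ≡ k) →
                          (∀ j → QtyAsk M₁ j ≡ QtyAsk M₂ j) → SameTrades M₁ M₂
  sameTrades-single-bid only₁ only₂ same-ask = record
    { bid-qty = bid-qty ; ask-qty = same-ask ; pair-qty = pair-qty }
    where
    J : List ℕ
    J = idsAsk M₁ ++ idsAsk M₂
    bid-qty : ∀ i → QtyBid M₁ i ≡ QtyBid M₂ i
    bid-qty i with i ≟ k
    ... | yes refl = begin
      QtyBid M₁ i                    ≡⟨ Qty-constant idBid M₁ only₁ ⟩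
      volume M₁                      ≡⟨ volume-by-Qty idAsk M₁ (λ t∈ → ∈-++⁺ˡ (∈-map⁺ idAsk t∈)) ⟩
      sumSet _≟_ (QtyAsk M₁) J       ≡⟨ sumSet-cong _≟_ J (λ {j} _ → same-ask j) ⟩
      sumSet _≟_ (QtyAsk M₂) J       ≡⟨ volume-by-Qty idAsk M₂ (λ t∈ → ∈-++⁺ʳ (idsAsk M₁) (∈-map⁺ idAsk t∈)) ⟨
      volume M₂                      ≡⟨ Qty-constant idBid M₂ only₂ ⟨
      QtyBid M₂ i                    ∎
      where open ≡-Reasoning
    ... | no i≢k = trans (Qty-constant-other idBid M₁ only₁ i≢k) (sym (Qty-constant-other idBid M₂ only₂ i≢k))
    pair-qty : ∀ i j → PairQty M₁ i j ≡ PairQty M₂ i j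
    pair-qty i j with i ≟ k
    ... | yes refl = trans (PairQty-bid only₁ j) (trans (same-ask j) (sym (PairQty-bid only₂ j)))
    ... | no i≢k = trans (PairQty-other-bid only₁ j i≢k) (sym (PairQty-other-bid only₂ j i≢k))

  sameTrades-single-ask : (∀ {t} → t ∈ M₁ → idAsk t ≡ k) → (∀ {t} → t ∈ M₂ → idAsk t ≡ k) →
                          (∀ i → QtyBid M₁ i ≡ QtyBid M₂ i) → SameTrades M₁ M₂
  sameTrades-single-ask only₁ only₂ same-bid = record
    { bid-qty = same-bid ; ask-qty = ask-qty ; pair-qty = pair-qty }
    where
    I : List ℕ
    I = idsBid M₁ ++ idsBid M₂
    ask-qty : ∀ j → QtyAsk M₁ j ≡ QtyAsk M₂ j
    ask-qty j with j ≟ k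
    ... | yes refl = begin
      QtyAsk M₁ j                    ≡⟨ Qty-constant idAsk M₁ only₁ ⟩
      volume M₁                      ≡⟨ volume-by-Qty idBid M₁ (λ t∈ → ∈-++⁺ˡ (∈-map⁺ idBid t∈)) ⟩
      sumSet _≟_ (QtyBid M₁) I       ≡⟨ sumSet-cong _≟_ I (λ {i} _ → same-bid i) ⟩
      sumSet _≟_ (QtyBid M₂) I       ≡⟨ volume-by-Qty idBid M₂ (λ t∈ → ∈-++⁺ʳ (idsBid M₁) (∈-map⁺ idBid t∈)) ⟨
      volume M₂                      ≡⟨ Qty-constant idAsk M₂ only₂ ⟨
      QtyAsk M₂ j                    ∎
      where open ≡-Reasoning
    ... | no j≢k = trans (Qty-constant-other idAsk M₁ only₁ j≢k) (sym (Qty-constant-other idAsk M₂ only₂ j≢k))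
    pair-qty : ∀ i j → PairQty M₁ i j ≡ PairQty M₂ i j
    pair-qty i j with j ≟ k
    ... | yes refl = trans (PairQty-ask only₁ i) (trans (same-bid i) (sym (PairQty-ask only₂ i)))
    ... | no j≢k = trans (PairQty-other-ask only₁ i j≢k) (sym (PairQty-other-ask only₂ i j≢k))

sameTrades-none : ∀ {M₁ M₂} → (∀ {t} → t ∉ M₁) → (∀ {t} → t ∉ M₂) → SameTrades M₁ M₂
sameTrades-none {M₁} {M₂} none₁ none₂ = record
  { bid-qty = λ _ → both-zero ; ask-qty = λ _ → both-zero ; pair-qty = λ _ _ → both-zero }
  where
  both-zero : ∀ {f g} → sumSet _≟ₜ_ f M₁ ≡ sumSet _≟ₜ_ g M₂
  both-zero = trans (sumSet-zero _≟ₜ_ M₁ (⊥-elim ∘ none₁)) (sym (sumSet-zero _≟ₜ_ M₂ (⊥-elim ∘ none₂)))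

≻ask-connex : ∀ a a' → timestamp a ≢ timestamp a' → a ≻ask a' ⊎ a' ≻ask a
≻ask-connex a a' ts≢ with <-cmp (price a) (price a')
... | tri< p< _ _ = inj₁ (inj₁ p<)
... | tri> _ _ p> = inj₂ (inj₁ p>)
... | tri≈ _ p≡ _ with <-cmp (timestamp a) (timestamp a')
...   | tri< t< _ _ = inj₁ (inj₂ (p≡ , t<))
...   | tri≈ _ t≡ _ = contradiction t≡ ts≢
...   | tri> _ _ t> = inj₂ (inj₂ (sym p≡ , t>))

≻bid-connex : ∀ b b' → timestamp b ≢ timestamp b' → b ≻bid b' ⊎ b' ≻bid b
≻bid-connex b b' ts≢ with <-cmp (price b) (price b')
... | tri< p< _ _ = inj₂ (inj₁ p<)
... | tri> _ _ p> = inj₁ (inj₁ p>)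
... | tri≈ _ p≡ _ with <-cmp (timestamp b) (timestamp b')
...   | tri< t< _ _ = inj₁ (inj₂ (p≡ , t<))
...   | tri≈ _ t≡ _ = contradiction t≡ ts≢
...   | tri> _ _ t> = inj₂ (inj₂ (sym p≡ , t>))

module Buy {B A : List Order} {β : Order} (unmatchable : ¬ Matchable B A) (adm : Admissible (β ∷ B) A) where

  bids-unique : UniqueIds (β ∷ B)
  bids-unique b∈ b'∈ = proj₁ adm (∈-++⁺ˡ b∈) (∈-++⁺ˡ b'∈)

  asks-unique : UniqueIds A
  asks-unique a∈ a'∈ = proj₁ adm (∈-++⁺ʳ (β ∷ B) a∈) (∈-++⁺ʳ (β ∷ B) a'∈)

  asks-connex : ∀ {a a'} → a ∈ A → a' ∈ A → id a ≢ id a' → a ≻ask a' ⊎ a' ≻ask a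
  asks-connex {a} {a'} a∈ a'∈ id≢ =
    ≻ask-connex a a' (id≢ ∘ cong id ∘ proj₂ adm (∈-++⁺ʳ (β ∷ B) a∈) (∈-++⁺ʳ (β ∷ B) a'∈))

  open PriorityFill A _≻ask_ (Tradable β) (qty β) asks-connex

  module _ {B̂ Â M} (out : Outcome (β ∷ B) A B̂ Â M) where
    open Outcome out

    trade-with-β : ∀ {t} → t ∈ M → idBid t ≡ id β × ∃ λ a → a ∈ A × idAsk t ≡ id a × Tradable β a
    trade-with-β t∈ with proj₁ matching t∈
    ... | _ , a , here refl , a∈ , bid≡ , ask≡ , tradable , _ = bid≡ , a , a∈ , ask≡ , tradable
    ... | b , a , there b∈ , a∈ , _ , _ , tradable , _ = ⊥-elim (unmatchable (b , a , b∈ , a∈ , tradable))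

    asks-traded : ∀ {t} → t ∈ M → idAsk t ∈ ids A
    asks-traded t∈ with _ , a , a∈ , ask≡ , _ ← trade-with-β t∈ = subst (_∈ ids A) (sym ask≡) (∈-map⁺ id a∈)

    β-traded : QtyBid M (id β) ≡ filled (QtyAsk M)
    β-traded = trans (Qty-constant idBid M (proj₁ ∘ trade-with-β)) (volume-by-Qty idAsk M asks-traded)

    asks-fill : IsPriorityFill (QtyAsk M)
    asks-fill = record
      { bounded   = proj₂ (proj₂ matching)
      ; within    = subst (_≤ qty β) β-traded (proj₁ (proj₂ matching) (here refl))
      ; priority  = λ a∈ a'∈ a≻a' pos → ask-priority a∈ a'∈ a≻a' (Qty-pos⇒∈ idAsk M pos)
      ; exhausted = exhausted
      ; eligible  = eligible
      }
      where
      exhausted : filled (QtyAsk M) < qty β → ∀ {a} → a ∈ A → Tradable β a → QtyAsk M (id a) ≡ qty a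
      exhausted short {a} a∈ tradable with QtyAsk M (id a) ≟ qty a
      ... | yes full = full
      ... | no ¬full = ⊥-elim (spread (_ , _ ,
              remainder-∈ (bidExecution M) bids-unique bids-rest (here refl) (subst (_< qty β) (sym β-traded) short) ,
              remainder-∈ (askExecution M) asks-unique asks-rest a∈ (≤∧≢⇒< (proj₂ (proj₂ matching) a∈) ¬full) ,
              tradable))
      eligible : ∀ {a} → a ∈ A → 0 < QtyAsk M (id a) → Tradable β a
      eligible a∈ pos with t , t∈ , ask≡ ← ∈-map⁻ idAsk (Qty-pos⇒∈ idAsk M pos)
                      with _ , a' , a'∈ , ask≡' , tradable ← trade-with-β t∈
                      with refl ← asks-unique a∈ a'∈ (trans ask≡ ask≡') = tradable

  sameTrades : ∀ {B̂₁ Â₁ M₁ B̂₂ Â₂ M₂} → Outcome (β ∷ B) A B̂₁ Â₁ M₁ → Outcome (β ∷ B) A B̂₂ Â₂ M₂ →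
               SameTrades M₁ M₂
  sameTrades {M₁ = M₁} {M₂ = M₂} out₁ out₂ =
    sameTrades-single-bid (proj₁ ∘ trade-with-β out₁) (proj₁ ∘ trade-with-β out₂) same-ask
    where
    same-ask : ∀ j → QtyAsk M₁ j ≡ QtyAsk M₂ j
    same-ask j with any? (j ≟_) (ids A)
    ... | yes j∈ with a , a∈ , refl ← ∈-map⁻ id j∈ = fill-unique (asks-fill out₁) (asks-fill out₂) a∈
    ... | no j∉ = trans (Qty-outside idAsk M₁ (asks-traded out₁) j∉) (sym (Qty-outside idAsk M₂ (asks-traded out₂) j∉))

module Sell {B A : List Order} {α : Order} (unmatchable : ¬ Matchable B A) (adm : Admissible B (α ∷ A)) where

  bids-unique : UniqueIds B
  bids-unique b∈ b'∈ = proj₁ adm (∈-++⁺ˡ b∈) (∈-++⁺ˡ b'∈)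

  asks-unique : UniqueIds (α ∷ A)
  asks-unique a∈ a'∈ = proj₁ adm (∈-++⁺ʳ B a∈) (∈-++⁺ʳ B a'∈)

  bids-connex : ∀ {b b'} → b ∈ B → b' ∈ B → id b ≢ id b' → b ≻bid b' ⊎ b' ≻bid b
  bids-connex {b} {b'} b∈ b'∈ id≢ = ≻bid-connex b b' (id≢ ∘ cong id ∘ proj₂ adm (∈-++⁺ˡ b∈) (∈-++⁺ˡ b'∈))

  open PriorityFill B _≻bid_ (λ b → Tradable b α) (qty α) bids-connex

  module _ {B̂ Â M} (out : Outcome B (α ∷ A) B̂ Â M) where
    open Outcome out

    trade-with-α : ∀ {t} → t ∈ M → idAsk t ≡ id α × ∃ λ b → b ∈ B × idBid t ≡ id b × Tradable b α
    trade-with-α t∈ with proj₁ matching t∈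
    ... | b , _ , b∈ , here refl , bid≡ , ask≡ , tradable , _ = ask≡ , b , b∈ , bid≡ , tradable
    ... | b , a , b∈ , there a∈ , _ , _ , tradable , _ = ⊥-elim (unmatchable (b , a , b∈ , a∈ , tradable))

    bids-traded : ∀ {t} → t ∈ M → idBid t ∈ ids B
    bids-traded t∈ with _ , b , b∈ , bid≡ , _ ← trade-with-α t∈ = subst (_∈ ids B) (sym bid≡) (∈-map⁺ id b∈)

    α-traded : QtyAsk M (id α) ≡ filled (QtyBid M)
    α-traded = trans (Qty-constant idAsk M (proj₁ ∘ trade-with-α)) (volume-by-Qty idBid M bids-traded)

    bids-fill : IsPriorityFill (QtyBid M)
    bids-fill = record
      { bounded   = proj₁ (proj₂ matching)
      ; within    = subst (_≤ qty α) α-traded (proj₂ (proj₂ matching) (here refl))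
      ; priority  = λ b∈ b'∈ b≻b' pos → bid-priority b∈ b'∈ b≻b' (Qty-pos⇒∈ idBid M pos)
      ; exhausted = exhausted
      ; eligible  = eligible
      }
      where
      exhausted : filled (QtyBid M) < qty α → ∀ {b} → b ∈ B → Tradable b α → QtyBid M (id b) ≡ qty b
      exhausted short {b} b∈ tradable with QtyBid M (id b) ≟ qty b
      ... | yes full = full
      ... | no ¬full = ⊥-elim (spread (_ , _ ,
              remainder-∈ (bidExecution M) bids-unique bids-rest b∈ (≤∧≢⇒< (proj₁ (proj₂ matching) b∈) ¬full) ,
              remainder-∈ (askExecution M) asks-unique asks-rest (here refl) (subst (_< qty α) (sym α-traded) short) ,
              tradable))
      eligible : ∀ {b} → b ∈ B → 0 < QtyBid M (id b) → Tradable b α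
      eligible b∈ pos with t , t∈ , bid≡ ← ∈-map⁻ idBid (Qty-pos⇒∈ idBid M pos)
                      with _ , b' , b'∈ , bid≡' , tradable ← trade-with-α t∈
                      with refl ← bids-unique b∈ b'∈ (trans bid≡ bid≡') = tradable

  sameTrades : ∀ {B̂₁ Â₁ M₁ B̂₂ Â₂ M₂} → Outcome B (α ∷ A) B̂₁ Â₁ M₁ → Outcome B (α ∷ A) B̂₂ Â₂ M₂ →
               SameTrades M₁ M₂
  sameTrades {M₁ = M₁} {M₂ = M₂} out₁ out₂ =
    sameTrades-single-ask (proj₁ ∘ trade-with-α out₁) (proj₁ ∘ trade-with-α out₂) same-bid
    where
    same-bid : ∀ i → QtyBid M₁ i ≡ QtyBid M₂ i
    same-bid i with any? (i ≟_) (ids B)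
    ... | yes i∈ with b , b∈ , refl ← ∈-map⁻ id i∈ = fill-unique (bids-fill out₁) (bids-fill out₂) b∈
    ... | no i∉ = trans (Qty-outside idBid M₁ (bids-traded out₁) i∉) (sym (Qty-outside idBid M₂ (bids-traded out₂) i∉))

no-trades : ∀ {B A B' A' M} → ¬ Matchable B A → B' ⊆ B → A' ⊆ A → Matching B' A' M → ∀ {t} → t ∉ M
no-trades unmatchable B'⊆B A'⊆A matching t∈ with b , a , b∈ , a∈ , _ , _ , tradable , _ ← proj₁ matching t∈ =
  unmatchable (b , a , B'⊆B b∈ , A'⊆A a∈ , tradable)

outcome : ∀ {P} → PriceTimePriority P → PositiveSpread P → Conservation P →
          ∀ {B A τ} → LegalInput B A τ →
          let (B' , A') = Absorb B A τ
              (B̂ , Â , M) = P B A τ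
          in Outcome B' A' B̂ Â M
outcome ptp ps cons {B} {A} {τ} legal = record
  { spread       = ps B A τ legal
  ; ask-priority = proj₁ (ptp B A τ legal)
  ; bid-priority = proj₂ (ptp B A τ legal)
  ; matching     = proj₁ (cons B A τ legal)
  ; bids-rest    = proj₁ (proj₂ (cons B A τ legal))
  ; asks-rest    = proj₂ (proj₂ (cons B A τ legal))
  }

legal-sameTrades : ∀ {B A} Δ {ω} → LegalInput B A (Δ , ω) → let (B' , A') = Absorb B A (Δ , ω) in
  ∀ {B̂₁ Â₁ M₁ B̂₂ Â₂ M₂} → Outcome B' A' B̂₁ Â₁ M₁ → Outcome B' A' B̂₂ Â₂ M₂ → SameTrades M₁ M₂
legal-sameTrades Buy  (unmatchable , adm) = Buy.sameTrades unmatchable adm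
legal-sameTrades Sell (unmatchable , adm) = Sell.sameTrades unmatchable adm
legal-sameTrades Del  (unmatchable , _) out₁ out₂ = sameTrades-none (none out₁) (none out₂)
  where
  none : ∀ {B̂ Â M} → Outcome _ _ B̂ Â M → ∀ {t} → t ∉ M
  none out = no-trades unmatchable (filter-⊆ _ _) (filter-⊆ _ _) (Outcome.matching out)

absorbed-⊆ : ∀ {B A} Δ ω → let (B' , A') = Absorb B A (Δ , ω) in B' ++ A' ⊆ (B ++ A) ++ [ ω ]
absorbed-⊆ {B} {A} Buy ω (here refl) = ∈-++⁺ʳ (B ++ A) (here refl)
absorbed-⊆ {B} {A} Buy ω (there o∈) = ∈-++⁺ˡ o∈
absorbed-⊆ {B} {A} Sell ω o∈ with ∈-++⁻ B o∈
... | inj₁ o∈B = ∈-++⁺ˡ (∈-++⁺ˡ o∈B)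
... | inj₂ (here refl) = ∈-++⁺ʳ (B ++ A) (here refl)
... | inj₂ (there o∈A) = ∈-++⁺ˡ (∈-++⁺ʳ B o∈A)
absorbed-⊆ {B} {A} Del ω = xs⊆xs++ys (B ++ A) [ ω ] ∘ ++⁺ (filter-⊆ _ B) (filter-⊆ _ A)

kept : (ω o : Order) → Dec (id o ≢ id ω)
kept ω o = ¬? (id o ≟ id ω)

deleted-absent : ∀ {B A} ω → let (B' , A') = Absorb B A (Del , ω) in ∀ {o} → o ∈ B' ++ A' → id o ≢ id ω
deleted-absent {B} {A} ω o∈ with ∈-++⁻ (filter (kept ω) B) o∈
... | inj₁ o∈B = proj₂ (∈-filter⁻ (kept ω) {xs = B} o∈B)
... | inj₂ o∈A = proj₂ (∈-filter⁻ (kept ω) {xs = A} o∈A)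

outcome-properties : ∀ {B A Δ ω B̂ Â M} → LegalInput B A (Δ , ω) →
  let (B' , A') = Absorb B A (Δ , ω) in Outcome B' A' B̂ Â M → OutputProperties B A Δ ω B̂ Â
outcome-properties {B} {A} {Δ} {ω} {B̂} {Â} (_ , adm) out =
  Outcome.spread out ,
  (output-injective out (proj₁ ∘ proj₂) (proj₂ adm) ,
   output-within out (proj₁ ∘ proj₂) (subst (_ ∈_) (++-assoc B A [ ω ]) ∘ absorbed-⊆ Δ ω)) ,
  (output-injective out proj₁ (proj₁ adm) ,
   subst (_ ∈_) (map-++ id (B ++ A) [ ω ]) ∘ output-within out proj₁ (absorbed-⊆ Δ ω)) ,
  deleted
  where
  deleted : Δ ≡ Del → id ω ∉ ids (B̂ ++ Â)
  deleted refl ω∈ with o , o∈ , id≡ ← ∈-map⁻ id ω∈ with b , b∈ , k ← output-origin out o∈ =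
    deleted-absent {B} {A} ω b∈ (trans (cong proj₁ k) (sym id≡))

outcomes-agree : ∀ {B A Δ ω B̂₁ Â₁ M₁ B̂₂ Â₂ M₂} → LegalInput B A (Δ , ω) →
  let (B' , A') = Absorb B A (Δ , ω) in
  Outcome B' A' B̂₁ Â₁ M₁ → Outcome B' A' B̂₂ Â₂ M₂ →
  ((B̂₁ ≐ B̂₂) × (Â₁ ≐ Â₂) × (C M₁ ≐ₚ C M₂)) ×
  OutputProperties B A Δ ω B̂₁ Â₁ × OutputProperties B A Δ ω B̂₂ Â₂
outcomes-agree {Δ = Δ} legal out₁ out₂ =
  outcome-determined (legal-sameTrades Δ legal out₁ out₂) out₁ out₂ ,
  outcome-properties legal out₁ ,
  outcome-properties legal out₂

theorem1 : (P₁ P₂ : Process) →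
    PriceTimePriority P₁ → PositiveSpread P₁ → Conservation P₁ →
    PriceTimePriority P₂ → PositiveSpread P₂ → Conservation P₂ →
    (B A : List Order) (Δ : Command) (ω : Order) →
    LegalInput B A (Δ , ω) →
    let (B̂₁ , Â₁ , M₁) = P₁ B A (Δ , ω)
        (B̂₂ , Â₂ , M₂) = P₂ B A (Δ , ω)
    in ((B̂₁ ≐ B̂₂) × (Â₁ ≐ Â₂) × (C M₁ ≐ₚ C M₂)) ×
       OutputProperties B A Δ ω B̂₁ Â₁ ×
       OutputProperties B A Δ ω B̂₂ Â₂
theorem1 P₁ P₂ ptp₁ ps₁ cons₁ ptp₂ ps₂ cons₂ B A Δ ω legal =
  outcomes-agree legal (outcome ptp₁ ps₁ cons₁ legal) (outcome ptp₂ ps₂ cons₂ legal)
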